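{- Let $G$ be a finite simple graph that is hole-free, paraglider-free and has no clique separator. Let $A$ be an induced subgraph of $G$ isomorphic to $\overline{C_6}$, with triangles $\mathrm{left}(A)$ and $\mathrm{right}(A)$, and let $xy$ be a matching edge of $A$ with $x\in\mathrm{left}(A)$, $y\in\mathrm{right}(A)$. Define $A_2[xy]$ as the set of vertices $u\notin V(A)$ with $N(u)\cap V(A)=\{x,y\}$, and $A_1[xy]$ as the set of edges $uv$ of $G$ with $u,v\notin V(A)$, $N(u)\cap V(A)=\{x\}$ and $N(v)\cap V(A)=\{y\}$. Then $A_1[xy]=A_2[xy]=\emptyset$.
   Context: A hole is an induced chordless cycle with at least five vertices. A paraglider is the graph on five vertices $u_1,u_2,w_1,w_2,p$ with edges $u_1u_2$, $u_iw_j$ for $i,j\in\{1,2\}$, $pw_1$, $pw_2$ (the complement of $P_2\cup P_3$). A graph is $H$-free if it has no induced subgraph isomorphic to $H$. A clique separator of $G$ is a clique $K$ such that $G[V\setminus K]$ has more connected components than $G$; a graph without clique separator is called an atom. $\overline{C_6}$ (complement of the chordless 6-cycle) consists of two disjoint triangles $\mathrm{left}(A)$, $\mathrm{right}(A)$ with a perfect matching between them; the edges of this matching are the matching edges. -}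

module Defs where

open import Data.Nat using (ℕ; zero; suc; _≤_; _<ᵇ_; _≡ᵇ_; _+_)
open import Data.Bool using (Bool; true; false; _∧_; _∨_; not)
open import Data.Fin using (Fin; toℕ; _↑ˡ_; _↑ʳ_)
open import Data.Fin.Subset using (Subset; _∈_; _∉_)
open import Data.Product using (Σ; _×_; ∃)
open import Data.Unit using (⊤)
open import Data.Sum using (_⊎_)
open import Function.Definitions using (Injective)
open import Function.Bundles using (_⇔_)
open import Relation.Nullary using (¬_)
open import Relation.Binary.PropositionalEquality using (_≡_; _≢_)

record Graph : Set where
  field
    n      : ℕ
    adj    : Fin n → Fin n → Bool
    sym    : ∀ u v → adj u v ≡ adj v u
    irrefl : ∀ u → adj u u ≡ false
open Graph public

Vtx : Graph → Set
Vtx G = Fin (n G)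

Embeds : (G : Graph) (k : ℕ) → (Fin k → Fin k → Bool) → Set
Embeds G k h = Σ (Fin k → Vtx G) λ f →
  Injective _≡_ _≡_ f × (∀ i j → adj G (f i) (f j) ≡ h i j)

cycAdj : (k : ℕ) → Fin k → Fin k → Bool
cycAdj k i j = let a = toℕ i ; b = toℕ j in
  (suc a ≡ᵇ b) ∨ (suc b ≡ᵇ a) ∨ ((a ≡ᵇ 0) ∧ (suc b ≡ᵇ k)) ∨ ((b ≡ᵇ 0) ∧ (suc a ≡ᵇ k))

HoleFree : Graph → Set
HoleFree G = ∀ k → 5 ≤ k → ¬ Embeds G k (cycAdj k)

-- paraglider: u1=0, u2=1, w1=2, w2=3, p=4
-- edges u1u2, u_i w_j, p w1, p w2
pgE : ℕ → ℕ → Bool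
pgE 0 1 = true
pgE 0 2 = true
pgE 0 3 = true
pgE 1 2 = true
pgE 1 3 = true
pgE 2 4 = true
pgE 3 4 = true
pgE _ _ = false

paragliderAdj : Fin 5 → Fin 5 → Bool
paragliderAdj i j = pgE (toℕ i) (toℕ j) ∨ pgE (toℕ j) (toℕ i)

ParagliderFree : Graph → Set
ParagliderFree G = ¬ Embeds G 5 paragliderAdj

-- complement of C6: left triangle {0,1,2}, right triangle {3,4,5},
-- matching edges i -- i+3
c6barAdj : Fin 6 → Fin 6 → Bool
c6barAdj i j = let a = toℕ i ; b = toℕ j in
  not (a ≡ᵇ b) ∧ (((a <ᵇ 3) ∧ (b <ᵇ 3)) ∨ (not (a <ᵇ 3) ∧ not (b <ᵇ 3))
                  ∨ (a + 3 ≡ᵇ b) ∨ (b + 3 ≡ᵇ a))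

leftV : Fin 3 → Fin 6
leftV i = i ↑ˡ 3

rightV : Fin 3 → Fin 6
rightV i = 3 ↑ʳ i

-- walks in G whose vertices after the start all satisfy P
data Reach (G : Graph) (P : Vtx G → Set) : Vtx G → Vtx G → Set where
  here : ∀ {a} → Reach G P a a
  step : ∀ {a c b} → adj G a c ≡ true → P c → Reach G P c b → Reach G P a b

IsClique : (G : Graph) → Subset (n G) → Set
IsClique G K = ∀ u v → u ∈ K → v ∈ K → u ≢ v → adj G u v ≡ true

-- K is a clique whose removal increases the number of components:
-- two vertices outside K, connected in G, are disconnected in G - K.
IsCliqueSeparator : (G : Graph) → Subset (n G) → Set
IsCliqueSeparator G K = IsClique G K × ∃ λ a → ∃ λ b →
  a ∉ K × b ∉ K × Reach G (λ _ → ⊤) a b × ¬ Reach G (λ c → c ∉ K) a b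

Atom : Graph → Set
Atom G = ∀ K → ¬ IsCliqueSeparator G K

Outside : (G : Graph) → (Fin 6 → Vtx G) → Vtx G → Set
Outside G f u = ∀ j → u ≢ f j

NbhdOn : (G : Graph) → (Fin 6 → Vtx G) → Vtx G → (Vtx G → Set) → Set
NbhdOn G f u S = ∀ j → (adj G u (f j) ≡ true) ⇔ S (f j)

module Submission where

-- By a rotation of A we may take x = f 0, y = f 3.  Let K consist of x, y
-- and all vertices complete to A; K is a clique, since two nonadjacent
-- vertices complete to A span a paraglider with three vertices of A.  A
-- vertex u of A₂[xy] (or the end u of an edge uv of A₁[xy]) is joined to
-- a₁ = f 1 through x, so as G is an atom some walk from u (or v) to a₁
-- avoids K.  Let z be the first vertex on it seeing one of 1, 2, 4, 5; all
-- vertices before z are clean (outside K, seeing only x and y in A).  A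
-- certified case analysis of the 64 neighbourhoods of z in A ('contact-table')
-- rules every one out: z sees none of 1, 2, 4, 5 or all of A (contradicting
-- the choice of z), or A + z contains a hole or a paraglider, or an induced
-- path from x or y to z through clean vertices closes a hole with one or two
-- vertices of A (in one short subcase, A + z + one vertex of the path
-- contains an obstruction).

open import Defs hiding (sym)
open import Data.Nat using (ℕ; zero; suc; _+_; _≤_; _≡ᵇ_)
open import Data.Nat.Properties using (suc-injective; ≡ᵇ⇒≡; ≡⇒≡ᵇ; ≤-refl; n≤1+n; m≤m+n)
open import Data.Bool using (Bool; true; false; _∧_; _∨_; not)
open import Data.Bool.Properties using (∨-identityʳ; ∨-conicalˡ; ∨-conicalʳ; ∧-conicalˡ; ∧-conicalʳ; T-≡)
open import Data.Fin as F using (Fin; toℕ; splitAt; join; #_)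
open import Data.Fin.Patterns using (0F; 1F; 2F; 3F; 4F; 5F)
open import Data.Fin.Properties using (toℕ-injective; join-splitAt) renaming (_≟_ to _≟F_)
open import Data.List using (List; []; _∷_; length; lookup)
open import Data.Vec as Vec using (Vec; tabulate; _∷_; [])
open import Data.Vec.Properties using (lookup∘tabulate; []=⇒lookup; lookup⇒[]=)
open import Data.Fin.Subset using (Subset; _∈_; _∉_)
open import Data.List.Relation.Unary.All as All using (All; []; _∷_)
open import Data.List.Membership.Propositional.Properties using (∈-lookup)
open import Data.Sum using (_⊎_; inj₁; inj₂) renaming (map to ⊎-map)
open import Data.Product using (_×_; _,_; proj₁; proj₂; Σ)
open import Data.Empty using (⊥; ⊥-elim)
open import Data.Unit using (⊤; tt)
open import Function using (id)
open import Function.Bundles using (Equivalence)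
open import Function.Definitions using (Injective)
open import Relation.Nullary using (¬_; yes; no)
open import Relation.Binary.PropositionalEquality
  using (_≡_; _≢_; refl; sym; trans; cong; subst)

-- Adjacency in Defs is Bool-valued, and all finite
-- case checks below are Bool computations closed by 'refl'; these lemmas
-- translate between such computations and propositions.

true≢false : true ≢ false
true≢false ()

∨-true-split : ∀ a b → a ∨ b ≡ true → a ≡ true ⊎ b ≡ true
∨-true-split true  _ _ = inj₁ refl
∨-true-split false _ e = inj₂ e

∨-trueˡ : ∀ {a} b → a ≡ true → a ∨ b ≡ true
∨-trueˡ _ refl = refl

∨-trueʳ : ∀ a {b} → b ≡ true → a ∨ b ≡ true
∨-trueʳ true  _ = refl
∨-trueʳ false e = e

∧-true : ∀ {a b} → a ≡ true → b ≡ true → a ∧ b ≡ true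
∧-true refl refl = refl

∧-true-split : ∀ {a b} → a ∧ b ≡ true → a ≡ true × b ≡ true
∧-true-split e = ∧-conicalˡ _ _ e , ∧-conicalʳ _ _ e

not-true : ∀ {b} → not b ≡ true → b ≡ false
not-true {false} _ = refl

bool-ext : ∀ b c → (b ≡ true → c ≡ true) → (c ≡ true → b ≡ true) → b ≡ c
bool-ext false false _ _ = refl
bool-ext false true  _ g = g refl
bool-ext true  false f _ = sym (f refl)
bool-ext true  true  _ _ = refl

_==_ : Bool → Bool → Bool
true  == true  = true
false == false = true
_     == _     = false

==-sound : ∀ a b → a == b ≡ true → a ≡ b
==-sound true  true  _ = refl
==-sound false false _ = refl

≡ᵇ-sound : ∀ m n → (m ≡ᵇ n) ≡ true → m ≡ n
≡ᵇ-sound m n e = ≡ᵇ⇒≡ m n (Equivalence.from T-≡ e)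

≡ᵇ-complete : ∀ m n → m ≡ n → (m ≡ᵇ n) ≡ true
≡ᵇ-complete m n p = Equivalence.to T-≡ (≡⇒≡ᵇ m n p)

-- Boolean equality on Fin, computing on closed indices
eqF : ∀ {k} → Fin k → Fin k → Bool
eqF i j = toℕ i ≡ᵇ toℕ j

eqF-sound : ∀ {k} (i j : Fin k) → eqF i j ≡ true → i ≡ j
eqF-sound i j e = toℕ-injective (≡ᵇ-sound _ _ e)

eqF-refl : ∀ {k} (i : Fin k) → eqF i i ≡ true
eqF-refl i = ≡ᵇ-complete (toℕ i) (toℕ i) refl

eqF-false : ∀ {k} {i j : Fin k} → eqF i j ≡ false → i ≢ j
eqF-false {i = i} e refl = true≢false (trans (sym (eqF-refl i)) e)

allFin : ∀ k → (Fin k → Bool) → Bool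
allFin zero    p = true
allFin (suc k) p = p 0F ∧ allFin k (λ i → p (F.suc i))

allFin-sound : ∀ k p → allFin k p ≡ true → ∀ i → p i ≡ true
allFin-sound (suc k) p e 0F        = ∧-conicalˡ _ _ e
allFin-sound (suc k) p e (F.suc i) = allFin-sound k (λ i → p (F.suc i)) (∧-conicalʳ _ _ e) i

inducedCopy : ∀ {m} k → (Fin m → Fin m → Bool) → (Fin k → Fin k → Bool) → (Fin k → Fin m) → Bool
inducedCopy k M H e = allFin k λ i → allFin k λ j →
  (M (e i) (e j) == H i j) ∧ (eqF i j ∨ not (eqF (e i) (e j)))

data Obstruction {m : ℕ} (M : Fin m → Fin m → Bool) : Set where
  paraglider : (e : Fin 5 → Fin m) → inducedCopy 5 M paragliderAdj e ≡ true → Obstruction M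
  hole : (k : ℕ) → 5 ≤ k → (e : Fin k → Fin m) → inducedCopy k M (cycAdj k) e ≡ true → Obstruction M

embeds-via : (G : Graph) {m k : ℕ} (M : Fin m → Fin m → Bool) (H : Fin k → Fin k → Bool)
  (e : Fin k → Fin m) (g : Fin m → Vtx G) → Injective _≡_ _≡_ g →
  (∀ a b → adj G (g a) (g b) ≡ M a b) → inducedCopy k M H e ≡ true → Embeds G k H
embeds-via G {k = k} M H e g g-inj g-adj ok = (λ i → g (e i)) , copy-inj , copy-adj
  where
  at : ∀ i j → ((M (e i) (e j) == H i j) ∧ (eqF i j ∨ not (eqF (e i) (e j)))) ≡ true
  at i j = allFin-sound k _ (allFin-sound k _ ok i) j
  copy-adj : ∀ i j → adj G (g (e i)) (g (e j)) ≡ H i j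
  copy-adj i j = trans (g-adj (e i) (e j)) (==-sound _ _ (∧-conicalˡ _ _ (at i j)))
  copy-inj : ∀ {i j} → g (e i) ≡ g (e j) → i ≡ j
  copy-inj {i} {j} q = eqF-sound i j (trans (sym (∨-identityʳ _)) distinct)
    where
    j-distinct : (eqF i j ∨ not (eqF (e j) (e j))) ≡ true
    j-distinct = subst (λ c → (eqF i j ∨ not (eqF c (e j))) ≡ true) (g-inj q) (∧-conicalʳ _ _ (at i j))
    distinct : (eqF i j ∨ false) ≡ true
    distinct = subst (λ b → (eqF i j ∨ not b) ≡ true) (eqF-refl (e j)) j-distinct

obstruction-absurd : (G : Graph) → HoleFree G → ParagliderFree G →
  {m : ℕ} {M : Fin m → Fin m → Bool} (g : Fin m → Vtx G) → Injective _≡_ _≡_ g →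
  (∀ a b → adj G (g a) (g b) ≡ M a b) → Obstruction M → ⊥
obstruction-absurd G hf pf {M = M} g g-inj g-adj (paraglider e ok) = pf (embeds-via G M _ e g g-inj g-adj ok)
obstruction-absurd G hf pf {M = M} g g-inj g-adj (hole k 5≤k e ok) = hf k 5≤k (embeds-via G M _ e g g-inj g-adj ok)

-- In Fin (6 + e)
-- the indices 0..5 are the vertices of A and 6.. the new ones.
extAdj⊎ : ∀ e → (Fin e → Fin 6 → Bool) → (Fin e → Fin e → Bool) → Fin 6 ⊎ Fin e → Fin 6 ⊎ Fin e → Bool
extAdj⊎ e P E (inj₁ a) (inj₁ b) = c6barAdj a b
extAdj⊎ e P E (inj₂ p) (inj₁ b) = P p b
extAdj⊎ e P E (inj₁ a) (inj₂ q) = P q a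
extAdj⊎ e P E (inj₂ p) (inj₂ q) = E p q

extAdj : ∀ e → (Fin e → Fin 6 → Bool) → (Fin e → Fin e → Bool) → Fin (6 + e) → Fin (6 + e) → Bool
extAdj e P E i j = extAdj⊎ e P E (splitAt 6 i) (splitAt 6 j)

splitAt-injective : ∀ m n {i j : Fin (m + n)} → splitAt m i ≡ splitAt m j → i ≡ j
splitAt-injective m n {i} {j} q =
  trans (sym (join-splitAt m n i)) (trans (cong (join m n) q) (join-splitAt m n j))

module Extension (G : Graph) (hf : HoleFree G) (pf : ParagliderFree G)
  (f : Fin 6 → Vtx G) (f-inj : Injective _≡_ _≡_ f)
  (f-adj : ∀ i j → adj G (f i) (f j) ≡ c6barAdj i j) where

  extension-absurd : ∀ e (P : Fin e → Fin 6 → Bool) (E : Fin e → Fin e → Bool) (ex : Fin e → Vtx G) →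
    (∀ p b → adj G (ex p) (f b) ≡ P p b) → (∀ p q → p ≢ q → adj G (ex p) (ex q) ≡ E p q) →
    (∀ p → E p p ≡ false) → (∀ p b → ex p ≢ f b) → Injective _≡_ _≡_ ex →
    Obstruction (extAdj e P E) → ⊥
  extension-absurd e P E ex ex-A ex-E E-irrefl ex-out ex-inj =
    obstruction-absurd G hf pf g (λ r → splitAt-injective 6 e (g⊎-inj _ _ r)) (λ a b → g⊎-adj (splitAt 6 a) (splitAt 6 b))
    where
    g⊎ : Fin 6 ⊎ Fin e → Vtx G
    g⊎ (inj₁ a) = f a
    g⊎ (inj₂ p) = ex p
    g : Fin (6 + e) → Vtx G
    g i = g⊎ (splitAt 6 i)
    g⊎-adj : ∀ a b → adj G (g⊎ a) (g⊎ b) ≡ extAdj⊎ e P E a b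
    g⊎-adj (inj₁ a) (inj₁ b) = f-adj a b
    g⊎-adj (inj₂ p) (inj₁ b) = ex-A p b
    g⊎-adj (inj₁ a) (inj₂ q) = trans (Graph.sym G (f a) (ex q)) (ex-A q a)
    g⊎-adj (inj₂ p) (inj₂ q) with p ≟F q
    ... | yes refl = trans (irrefl G (ex p)) (sym (E-irrefl p))
    ... | no p≢q   = ex-E p q p≢q
    g⊎-inj : ∀ a b → g⊎ a ≡ g⊎ b → a ≡ b
    g⊎-inj (inj₁ a) (inj₁ b) r = cong inj₁ (f-inj r)
    g⊎-inj (inj₂ p) (inj₁ b) r = ⊥-elim (ex-out p b r)
    g⊎-inj (inj₁ a) (inj₂ q) r = ⊥-elim (ex-out q a (sym r))
    g⊎-inj (inj₂ p) (inj₂ q) r = cong inj₂ (ex-inj r)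

CycleAdj : ℕ → ℕ → ℕ → Set
CycleAdj k a b = suc a ≡ b ⊎ suc b ≡ a ⊎ (a ≡ 0 × suc b ≡ k) ⊎ (b ≡ 0 × suc a ≡ k)

cycAdj-sound : ∀ k (i j : Fin k) → cycAdj k i j ≡ true → CycleAdj k (toℕ i) (toℕ j)
cycAdj-sound k i j e with ∨-true-split _ _ e
... | inj₁ e₁ = inj₁ (≡ᵇ-sound _ _ e₁)
... | inj₂ e₂ with ∨-true-split _ _ e₂
...   | inj₁ e₃ = inj₂ (inj₁ (≡ᵇ-sound _ _ e₃))
...   | inj₂ e₄ with ∨-true-split _ _ e₄
...     | inj₁ e₅ = inj₂ (inj₂ (inj₁ (≡ᵇ-sound _ _ (∧-conicalˡ _ _ e₅) , ≡ᵇ-sound _ _ (∧-conicalʳ _ _ e₅))))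
...     | inj₂ e₆ = inj₂ (inj₂ (inj₂ (≡ᵇ-sound _ _ (∧-conicalˡ _ _ e₆) , ≡ᵇ-sound _ _ (∧-conicalʳ _ _ e₆))))

cycAdj-complete : ∀ k (i j : Fin k) → CycleAdj k (toℕ i) (toℕ j) → cycAdj k i j ≡ true
cycAdj-complete k i j (inj₁ p) =
  ∨-trueˡ _ (≡ᵇ-complete _ _ p)
cycAdj-complete k i j (inj₂ (inj₁ p)) =
  ∨-trueʳ (suc (toℕ i) ≡ᵇ toℕ j) (∨-trueˡ _ (≡ᵇ-complete _ _ p))
cycAdj-complete k i j (inj₂ (inj₂ (inj₁ (p , q)))) =
  ∨-trueʳ (suc (toℕ i) ≡ᵇ toℕ j) (∨-trueʳ (suc (toℕ j) ≡ᵇ toℕ i)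
    (∨-trueˡ _ (∧-true (≡ᵇ-complete _ _ p) (≡ᵇ-complete _ _ q))))
cycAdj-complete k i j (inj₂ (inj₂ (inj₂ (p , q)))) =
  ∨-trueʳ (suc (toℕ i) ≡ᵇ toℕ j) (∨-trueʳ (suc (toℕ j) ≡ᵇ toℕ i)
    (∨-trueʳ ((toℕ i ≡ᵇ 0) ∧ (suc (toℕ j) ≡ᵇ k)) (∧-true (≡ᵇ-complete _ _ p) (≡ᵇ-complete _ _ q))))

CycleAdj-sym : ∀ {k a b} → CycleAdj k a b → CycleAdj k b a
CycleAdj-sym (inj₁ p)                = inj₂ (inj₁ p)
CycleAdj-sym (inj₂ (inj₁ p))         = inj₁ p
CycleAdj-sym (inj₂ (inj₂ (inj₁ p))) = inj₂ (inj₂ (inj₂ p))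
CycleAdj-sym (inj₂ (inj₂ (inj₂ p))) = inj₂ (inj₂ (inj₁ p))

cycAdj-sym : ∀ k (i j : Fin k) → cycAdj k i j ≡ cycAdj k j i
cycAdj-sym k i j = bool-ext _ _
  (λ e → cycAdj-complete k j i (CycleAdj-sym (cycAdj-sound k i j e)))
  (λ e → cycAdj-complete k i j (CycleAdj-sym (cycAdj-sound k j i e)))

module Paths (G : Graph) where

  private
    V : Set
    V = Vtx G

  adj⇒≢ : ∀ {a b} → adj G a b ≡ true → a ≢ b
  adj⇒≢ {a} e refl = true≢false (trans (sym e) (irrefl G a))

  Far : V → V → Set
  Far a w = adj G a w ≡ false × a ≢ w

  Walk : List V → Set
  Walk []          = ⊤
  Walk (a ∷ [])    = ⊤
  Walk (a ∷ b ∷ l) = adj G a b ≡ true × Walk (b ∷ l)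

  InducedPath : List V → Set
  InducedPath []          = ⊤
  InducedPath (a ∷ [])    = ⊤
  InducedPath (a ∷ b ∷ l) = adj G a b ≡ true × All (Far a) l × InducedPath (b ∷ l)

  data Last : List V → V → Set where
    last-here  : ∀ {a} → Last (a ∷ []) a
    last-there : ∀ {a l b} → Last l b → Last (a ∷ l) b

  data Suffix : List V → List V → Set where
    suffix-refl  : ∀ {l} → Suffix l l
    suffix-there : ∀ {l a m} → Suffix l m → Suffix l (a ∷ m)

  InducedPath-tail : ∀ {a l} → InducedPath (a ∷ l) → InducedPath l
  InducedPath-tail {l = []}    _           = tt
  InducedPath-tail {l = b ∷ l} (_ , _ , i) = i

  InducedPath-suffix : ∀ {l m} → Suffix l m → InducedPath m → InducedPath l
  InducedPath-suffix suffix-refl      i = i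
  InducedPath-suffix (suffix-there s) i = InducedPath-suffix s (InducedPath-tail i)

  All-suffix : ∀ {P : V → Set} {l m} → Suffix l m → All P m → All P l
  All-suffix suffix-refl      ps       = ps
  All-suffix (suffix-there s) (_ ∷ ps) = All-suffix s ps

  Last-tail : ∀ {a c l b} → Last (a ∷ c ∷ l) b → Last (c ∷ l) b
  Last-tail (last-there p) = p

  Last-suffix : ∀ {c l m b} → Suffix (c ∷ l) m → Last m b → Last (c ∷ l) b
  Last-suffix suffix-refl                    p = p
  Last-suffix (suffix-there {m = []} ())     p
  Last-suffix (suffix-there {m = d ∷ m} s) p = Last-suffix s (Last-tail p)

  record LastHit (r : V → Bool) (l : List V) : Set where
    field
      hit    : V
      after  : List V
      suffix : Suffix (hit ∷ after) l
      hits   : r hit ≡ true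
      misses : All (λ w → r w ≡ false) after

  anyHit : (V → Bool) → List V → Bool
  anyHit r []      = false
  anyHit r (a ∷ l) = r a ∨ anyHit r l

  anyHit-false : ∀ r l → anyHit r l ≡ false → All (λ w → r w ≡ false) l
  anyHit-false r []      e = []
  anyHit-false r (a ∷ l) e with r a in ra
  ... | false = ra ∷ anyHit-false r l e
  ... | true  = ⊥-elim (true≢false e)

  lastHit : (r : V → Bool) (l : List V) → anyHit r l ≡ true → LastHit r l
  lastHit r (a ∷ l) e with anyHit r l in e'
  ... | true  = let h = lastHit r l e' in
                record { LastHit h ; suffix = suffix-there (LastHit.suffix h) }
  ... | false = record { hit = a ; after = l ; suffix = suffix-refl
                       ; hits = trans (sym (∨-identityʳ (r a))) e ; misses = anyHit-false r l e' }

  record InducedSubpath (Q : V → Set) (a : V) (l : List V) : Set where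
    field
      path     : List V
      induced  : InducedPath (a ∷ path)
      inside   : All Q (a ∷ path)
      same-end : ∀ {b} → Last (a ∷ l) b → Last (a ∷ path) b

  -- Every walk can be shortened to an induced path between its ends: from
  -- a, jump to the last vertex of the (recursively shortened) remainder
  -- that is equal or adjacent to a.
  shortcut : {Q : V → Set} (a : V) (l : List V) → Walk (a ∷ l) → All Q (a ∷ l) → InducedSubpath Q a l
  shortcut a [] _ qs = record { path = [] ; induced = tt ; inside = qs ; same-end = id }
  shortcut {Q} a (b ∷ l) (ab , walk) (qa ∷ qs) = attach
    where
    open InducedSubpath (shortcut b l walk qs)
      renaming (path to p; induced to p-induced; inside to p-inside; same-end to p-end)
    near : V → Bool
    near w = eqF a w ∨ adj G a w
    open LastHit (lastHit near (b ∷ p) (∨-trueˡ _ (∨-trueʳ (eqF a b) ab)))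
    hit-induced : InducedPath (hit ∷ after)
    hit-induced = InducedPath-suffix suffix p-induced
    hit-inside : All Q (hit ∷ after)
    hit-inside = All-suffix suffix p-inside
    hit-end : ∀ {e} → Last (a ∷ b ∷ l) e → Last (hit ∷ after) e
    hit-end q = Last-suffix suffix (p-end (Last-tail q))
    far : ∀ {w} → near w ≡ false → Far a w
    far e = ∨-conicalʳ _ _ e , eqF-false (∨-conicalˡ _ _ e)
    attach : InducedSubpath Q a (b ∷ l)
    attach with eqF a hit in a≟hit
    ... | true = record
      { path     = after
      ; induced  = subst (λ v → InducedPath (v ∷ after)) (sym a≡hit) hit-induced
      ; inside   = qa ∷ All.tail hit-inside
      ; same-end = λ q → subst (λ v → Last (v ∷ after) _) (sym a≡hit) (hit-end q) }
      where a≡hit = eqF-sound a hit a≟hit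
    ... | false = record
      { path     = hit ∷ after
      ; induced  = subst (λ t → (t ∨ adj G a hit) ≡ true) a≟hit hits , All.map far misses , hit-induced
      ; inside   = qa ∷ hit-inside
      ; same-end = λ q → last-there (hit-end q) }

  record WalkIn (P : V → Set) (a b : V) : Set where
    field
      rest   : List V
      walk   : Walk (a ∷ rest)
      ends   : Last (a ∷ rest) b
      inside : All P rest

  reach-walk : ∀ {P a b} → Reach G P a b → WalkIn P a b
  reach-walk here = record { rest = [] ; walk = tt ; ends = last-here ; inside = [] }
  reach-walk (step a-c Pc r) = record
    { rest = _ ∷ rest ; walk = a-c , walk ; ends = last-there ends ; inside = Pc ∷ inside }
    where open WalkIn (reach-walk r)

  All-at : ∀ {P : V → Set} {l : List V} → All P l → ∀ k → P (lookup l k)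
  All-at ps k = All.lookup ps (∈-lookup k)

  head-sees-only-next : ∀ {a b l} → InducedPath (a ∷ b ∷ l) → ∀ j →
    adj G a (lookup (b ∷ l) j) ≡ true → toℕ j ≡ 0
  head-sees-only-next _               0F        _ = refl
  head-sees-only-next (_ , far-a , _) (F.suc k) e = ⊥-elim (true≢false (trans (sym e) (proj₁ (All-at far-a k))))

  induced-adj-sound : ∀ L → InducedPath L → ∀ i j → adj G (lookup L i) (lookup L j) ≡ true →
    suc (toℕ i) ≡ toℕ j ⊎ suc (toℕ j) ≡ toℕ i
  induced-adj-sound (a ∷ []) _ 0F 0F e = ⊥-elim (adj⇒≢ e refl)
  induced-adj-sound (a ∷ b ∷ l) ind 0F 0F e = ⊥-elim (adj⇒≢ e refl)
  induced-adj-sound (a ∷ b ∷ l) ind 0F (F.suc j) e =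
    inj₁ (cong suc (sym (head-sees-only-next ind j e)))
  induced-adj-sound (a ∷ b ∷ l) ind (F.suc i) 0F e =
    inj₂ (cong suc (sym (head-sees-only-next ind i (trans (Graph.sym G _ _) e))))
  induced-adj-sound (a ∷ b ∷ l) (_ , _ , ind) (F.suc i) (F.suc j) e with induced-adj-sound (b ∷ l) ind i j e
  ... | inj₁ p = inj₁ (cong suc p)
  ... | inj₂ p = inj₂ (cong suc p)

  induced-adj-complete : ∀ L → InducedPath L → ∀ i j → suc (toℕ i) ≡ toℕ j →
    adj G (lookup L i) (lookup L j) ≡ true
  induced-adj-complete (a ∷ b ∷ l) (ab , _) 0F 1F _ = ab
  induced-adj-complete (a ∷ b ∷ l) (_ , _ , ind) (F.suc i) (F.suc j) p =
    induced-adj-complete (b ∷ l) ind i j (suc-injective p)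

  head-distinct : ∀ {a b l} → InducedPath (a ∷ b ∷ l) → ∀ j → a ≢ lookup (b ∷ l) j
  head-distinct (ab , _ , _)    0F        = adj⇒≢ ab
  head-distinct (_ , far-a , _) (F.suc k) = proj₂ (All-at far-a k)

  induced-injective : ∀ L → InducedPath L → ∀ i j → lookup L i ≡ lookup L j → i ≡ j
  induced-injective (a ∷ []) _ 0F 0F _ = refl
  induced-injective (a ∷ b ∷ l) _ 0F 0F _ = refl
  induced-injective (a ∷ b ∷ l) ind 0F (F.suc j) e = ⊥-elim (head-distinct ind j e)
  induced-injective (a ∷ b ∷ l) ind (F.suc i) 0F e = ⊥-elim (head-distinct ind i (sym e))
  induced-injective (a ∷ b ∷ l) (_ , _ , ind) (F.suc i) (F.suc j) e =
    cong F.suc (induced-injective (b ∷ l) ind i j e)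

  last-position : ∀ {L e} → Last L e → Σ (Fin (length L)) λ j → lookup L j ≡ e × suc (toℕ j) ≡ length L
  last-position last-here      = 0F , refl , refl
  last-position (last-there p) with last-position p
  ... | j , at , pos = F.suc j , at , cong suc pos

  module CycleThroughApex (apex b e : V) (Q : List V) (ind : InducedPath (b ∷ Q)) (end : Last (b ∷ Q) e)
    (apex-b : adj G apex b ≡ true) (apex-e : adj G apex e ≡ true)
    (only-ends : All (λ w → w ≡ e ⊎ Far apex w) Q) where

    L : List V
    L = b ∷ Q

    K : ℕ
    K = suc (length L)

    cycle : Fin K → V
    cycle = lookup (apex ∷ L)

    at-end : ∀ j → suc (toℕ j) ≡ length L → lookup L j ≡ e
    at-end j p with last-position end
    ... | j-e , at , pos = trans (cong (lookup L) (toℕ-injective (suc-injective (trans p (sym pos))))) at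

    end-at : ∀ j → lookup L j ≡ e → suc (toℕ j) ≡ length L
    end-at j p with last-position end
    ... | j-e , at , pos = trans (cong (λ i → suc (toℕ i)) (induced-injective L ind j j-e (trans p (sym at)))) pos

    apex-sees : ∀ j → adj G apex (lookup L j) ≡ true → toℕ j ≡ 0 ⊎ suc (toℕ j) ≡ length L
    apex-sees 0F        _ = inj₁ refl
    apex-sees (F.suc k) a with All-at only-ends k
    ... | inj₁ is-e       = inj₂ (end-at (F.suc k) is-e)
    ... | inj₂ (nonadj , _) = ⊥-elim (true≢false (trans (sym a) nonadj))

    sees-apex : ∀ j → toℕ j ≡ 0 ⊎ suc (toℕ j) ≡ length L → adj G apex (lookup L j) ≡ true
    sees-apex 0F        _        = apex-b
    sees-apex (F.suc k) (inj₂ p) = subst (λ v → adj G apex v ≡ true) (sym (at-end (F.suc k) p)) apex-e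

    apex-distinct : ∀ j → apex ≢ lookup L j
    apex-distinct 0F = adj⇒≢ apex-b
    apex-distinct (F.suc k) with All-at only-ends k
    ... | inj₁ is-e           = λ r → adj⇒≢ apex-e (trans r is-e)
    ... | inj₂ (_ , distinct) = distinct

    cycle-injective : Injective _≡_ _≡_ cycle
    cycle-injective {0F}      {0F}      _ = refl
    cycle-injective {0F}      {F.suc j} r = ⊥-elim (apex-distinct j r)
    cycle-injective {F.suc i} {0F}      r = ⊥-elim (apex-distinct i (sym r))
    cycle-injective {F.suc i} {F.suc j} r = cong F.suc (induced-injective L ind i j r)

    apex-adj : ∀ j → adj G apex (lookup L j) ≡ cycAdj K 0F (F.suc j)
    apex-adj j = bool-ext _ _ to from
      where
      to : adj G apex (lookup L j) ≡ true → cycAdj K 0F (F.suc j) ≡ true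
      to a with apex-sees j a
      ... | inj₁ first = cycAdj-complete K 0F (F.suc j) (inj₁ (cong suc (sym first)))
      ... | inj₂ final = cycAdj-complete K 0F (F.suc j) (inj₂ (inj₂ (inj₁ (refl , cong suc final))))
      from : cycAdj K 0F (F.suc j) ≡ true → adj G apex (lookup L j) ≡ true
      from c with cycAdj-sound K 0F (F.suc j) c
      ... | inj₁ p                     = sees-apex j (inj₁ (sym (suc-injective p)))
      ... | inj₂ (inj₂ (inj₁ (_ , p))) = sees-apex j (inj₂ (suc-injective p))

    path-adj : ∀ i j → adj G (lookup L i) (lookup L j) ≡ cycAdj K (F.suc i) (F.suc j)
    path-adj i j = bool-ext _ _ to from
      where
      to : adj G (lookup L i) (lookup L j) ≡ true → cycAdj K (F.suc i) (F.suc j) ≡ true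
      to a with induced-adj-sound L ind i j a
      ... | inj₁ p = cycAdj-complete K (F.suc i) (F.suc j) (inj₁ (cong suc p))
      ... | inj₂ p = cycAdj-complete K (F.suc i) (F.suc j) (inj₂ (inj₁ (cong suc p)))
      from : cycAdj K (F.suc i) (F.suc j) ≡ true → adj G (lookup L i) (lookup L j) ≡ true
      from c with cycAdj-sound K (F.suc i) (F.suc j) c
      ... | inj₁ p         = induced-adj-complete L ind i j (suc-injective p)
      ... | inj₂ (inj₁ p) = trans (Graph.sym G _ _) (induced-adj-complete L ind j i (suc-injective p))
      ... | inj₂ (inj₂ (inj₁ (() , _)))
      ... | inj₂ (inj₂ (inj₂ (() , _)))

    cycle-adj : ∀ i j → adj G (cycle i) (cycle j) ≡ cycAdj K i j
    cycle-adj 0F        0F        = irrefl G apex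
    cycle-adj 0F        (F.suc j) = apex-adj j
    cycle-adj (F.suc i) 0F        =
      trans (Graph.sym G _ _) (trans (apex-adj i) (cycAdj-sym K 0F (F.suc i)))
    cycle-adj (F.suc i) (F.suc j) = path-adj i j

  induced-cycle : (apex b e : V) (Q : List V) → InducedPath (b ∷ Q) → Last (b ∷ Q) e →
    adj G apex b ≡ true → adj G apex e ≡ true → All (λ w → w ≡ e ⊎ Far apex w) Q →
    Embeds G (suc (suc (length Q))) (cycAdj (suc (suc (length Q))))
  induced-cycle apex b e Q ind end apex-b apex-e only-ends = cycle , cycle-injective , cycle-adj
    where open CycleThroughApex apex b e Q ind end apex-b apex-e only-ends

  record PathFrom (Q : V → Set) (v z : V) : Set where
    field
      start   : V
      rest    : List V
      induced : InducedPath (start ∷ rest)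
      ends    : Last (start ∷ rest) z
      inside  : All Q (start ∷ rest)
      v-start : adj G v start ≡ true
      v-rest  : All (λ w → adj G v w ≡ false) rest

  path-from : {Q : V → Set} (v p : V) (L : List V) {z : V} → Walk (p ∷ L) → Last (p ∷ L) z →
    All Q (p ∷ L) → adj G p v ≡ true → PathFrom Q v z
  path-from {Q} v p L walk end inQ p-v = record
    { start   = hit
    ; rest    = after
    ; induced = InducedPath-suffix suffix induced
    ; ends    = Last-suffix suffix (same-end end)
    ; inside  = All-suffix suffix inside
    ; v-start = hits
    ; v-rest  = misses }
    where
    open InducedSubpath (shortcut p L walk inQ)
    open LastHit (lastHit (adj G v) (p ∷ path) (∨-trueˡ _ (trans (Graph.sym G v p) p-v)))

-- The neighbourhood in A of a vertex z outside A is a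
-- pattern s (entry j: is z adjacent to the j-th vertex of A).  The matching
-- edge under study is xy with x = 0, y = 3; the other four vertices of A
-- are 1, 2 (left) and 4, 5 (right).
Pattern : Set
Pattern = Vec Bool 6

onXY : Fin 6 → Bool
onXY j = eqF j 0F ∨ eqF j 3F

touchesOff : Pattern → Bool
touchesOff s = Vec.lookup s 1F ∨ (Vec.lookup s 2F ∨ (Vec.lookup s 4F ∨ Vec.lookup s 5F))

completeTo : Pattern → Bool
completeTo s = allFin 6 (Vec.lookup s)

data Anchor : Set where
  atX atY : Anchor

anchor : Anchor → Fin 6
anchor atX = 0F
anchor atY = 3F

off-anchor : ∀ a {t} → onXY t ≡ false → t ≢ anchor a
off-anchor atX e refl = true≢false e
off-anchor atY e refl = true≢false e

-- the shape of a hole t' – a – (path) – z – t – t': t and t' are off xy,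
-- t ~ t' ~ a, t ≁ a, and z sees t but neither a nor t'
record AnchorHole (s : Pattern) (a : Anchor) (t t' : Fin 6) : Set where
  field
    t-t'   : c6barAdj t t' ≡ true
    t'-a   : c6barAdj t' (anchor a) ≡ true
    t-a    : c6barAdj t (anchor a) ≡ false
    t-off  : onXY t ≡ false
    t'-off : onXY t' ≡ false
    z-t    : Vec.lookup s t ≡ true
    z-a    : Vec.lookup s (anchor a) ≡ false
    z-t'   : Vec.lookup s t' ≡ false

anchorHole? : Pattern → Anchor → Fin 6 → Fin 6 → Bool
anchorHole? s a t t' =
  c6barAdj t t' ∧ (c6barAdj t' (anchor a) ∧ (not (c6barAdj t (anchor a)) ∧ (not (onXY t) ∧
  (not (onXY t') ∧ (Vec.lookup s t ∧ (not (Vec.lookup s (anchor a)) ∧ not (Vec.lookup s t')))))))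

anchorHole-sound : ∀ s a t t' → anchorHole? s a t t' ≡ true → AnchorHole s a t t'
anchorHole-sound s a t t' e =
  let (e₁ , r₁) = ∧-true-split e  ; (e₂ , r₂) = ∧-true-split r₁ ; (e₃ , r₃) = ∧-true-split r₂
      (e₄ , r₄) = ∧-true-split r₃ ; (e₅ , r₅) = ∧-true-split r₄ ; (e₆ , r₆) = ∧-true-split r₅
      (e₇ , e₈) = ∧-true-split r₆
  in record { t-t' = e₁ ; t'-a = e₂ ; t-a = not-true e₃ ; t-off = not-true e₄ ; t'-off = not-true e₅
            ; z-t = e₆ ; z-a = not-true e₇ ; z-t' = not-true e₈ }

-- the shape of a hole t – x – (path) – z – t: t is off xy, t ~ x, and z
-- sees t but not x
record XHole (s : Pattern) (t : Fin 6) : Set where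
  field
    t-x   : c6barAdj t 0F ≡ true
    t-off : onXY t ≡ false
    z-t   : Vec.lookup s t ≡ true
    z-x   : Vec.lookup s 0F ≡ false

xHole? : Pattern → Fin 6 → Bool
xHole? s t = c6barAdj t 0F ∧ (not (onXY t) ∧ (Vec.lookup s t ∧ not (Vec.lookup s 0F)))

xHole-sound : ∀ s t → xHole? s t ≡ true → XHole s t
xHole-sound s t e =
  let (e₁ , r₁) = ∧-true-split e ; (e₂ , r₂) = ∧-true-split r₁ ; (e₃ , e₄) = ∧-true-split r₂
  in record { t-x = e₁ ; t-off = not-true e₂ ; z-t = e₃ ; z-x = not-true e₄ }

withZ : Pattern → Fin (6 + 1) → Fin (6 + 1) → Bool
withZ s = extAdj 1 (λ _ → Vec.lookup s) (λ _ _ → false)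

-- A plus z with pattern s and a neighbour c of z whose only neighbours in
-- A are x and possibly (flag c-y) y
zcPattern : Pattern → Bool → Fin 2 → Fin 6 → Bool
zcPattern s c-y 0F = Vec.lookup s
zcPattern s c-y 1F = Vec.lookup (true ∷ false ∷ false ∷ c-y ∷ false ∷ false ∷ [])

withZC : Pattern → Bool → Fin (6 + 2) → Fin (6 + 2) → Bool
withZC s c-y = extAdj 2 (zcPattern s c-y) (λ p q → not (eqF p q))

-- Why no vertex z outside A with pattern s can be the first vertex
-- touching A \ {x, y} on a path from the edge xy:
data Contact (s : Pattern) : Set where
  no-contact       : touchesOff s ≡ false → Contact s
  -- z is complete to A, hence in the separator
  complete-contact : completeTo s ≡ true → Contact s
  local            : Obstruction (withZ s) → Contact s
  -- a path from an anchor to z closes a hole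
  via-anchor       : (a : Anchor) (t t' : Fin 6) → anchorHole? s a t t' ≡ true → Contact s
  -- a path from x to z closes a hole if it is long, and if it is x – c – z
  -- then A + z + c contains an obstruction whether or not c ~ y
  via-x            : (t : Fin 6) → xHole? s t ≡ true → ((c-y : Bool) → Obstruction (withZC s c-y)) → Contact s

contact-table : ∀ s → Contact s
contact-table (false ∷ false ∷ false ∷ false ∷ false ∷ false ∷ [])
  = no-contact refl
contact-table (false ∷ false ∷ false ∷ false ∷ false ∷ true ∷ [])
  = via-anchor atX 5F 2F refl
contact-table (false ∷ false ∷ false ∷ false ∷ true ∷ false ∷ [])
  = via-anchor atX 4F 1F refl
contact-table (false ∷ false ∷ false ∷ false ∷ true ∷ true ∷ [])
  = via-anchor atX 4F 1F refl
contact-table (false ∷ false ∷ false ∷ true ∷ false ∷ false ∷ [])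
  = no-contact refl
contact-table (false ∷ false ∷ false ∷ true ∷ false ∷ true ∷ [])
  = via-anchor atX 5F 2F refl
contact-table (false ∷ false ∷ false ∷ true ∷ true ∷ false ∷ [])
  = via-anchor atX 4F 1F refl
contact-table (false ∷ false ∷ false ∷ true ∷ true ∷ true ∷ [])
  = via-anchor atX 4F 1F refl
contact-table (false ∷ false ∷ true ∷ false ∷ false ∷ false ∷ [])
  = via-anchor atY 2F 5F refl
contact-table (false ∷ false ∷ true ∷ false ∷ false ∷ true ∷ [])
  = via-x 2F refl (λ { false → hole 5 ≤-refl (Vec.lookup (# 0 ∷ # 3 ∷ # 5 ∷ # 6 ∷ # 7 ∷ [])) refl ; true → hole 6 (n≤1+n 5) (Vec.lookup (# 0 ∷ # 1 ∷ # 4 ∷ # 5 ∷ # 6 ∷ # 7 ∷ [])) refl })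
contact-table (false ∷ false ∷ true ∷ false ∷ true ∷ false ∷ [])
  = via-anchor atY 2F 5F refl
contact-table (false ∷ false ∷ true ∷ false ∷ true ∷ true ∷ [])
  = via-anchor atX 4F 1F refl
contact-table (false ∷ false ∷ true ∷ true ∷ false ∷ false ∷ [])
  = local (hole 5 ≤-refl (Vec.lookup (# 1 ∷ # 2 ∷ # 6 ∷ # 3 ∷ # 4 ∷ [])) refl)
contact-table (false ∷ false ∷ true ∷ true ∷ false ∷ true ∷ [])
  = local (paraglider (Vec.lookup (# 5 ∷ # 6 ∷ # 2 ∷ # 3 ∷ # 0 ∷ [])) refl)
contact-table (false ∷ false ∷ true ∷ true ∷ true ∷ false ∷ [])
  = via-anchor atX 4F 1F refl
contact-table (false ∷ false ∷ true ∷ true ∷ true ∷ true ∷ [])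
  = via-anchor atX 4F 1F refl
contact-table (false ∷ true ∷ false ∷ false ∷ false ∷ false ∷ [])
  = via-anchor atY 1F 4F refl
contact-table (false ∷ true ∷ false ∷ false ∷ false ∷ true ∷ [])
  = via-anchor atY 1F 4F refl
contact-table (false ∷ true ∷ false ∷ false ∷ true ∷ false ∷ [])
  = via-x 1F refl (λ { false → hole 5 ≤-refl (Vec.lookup (# 0 ∷ # 3 ∷ # 4 ∷ # 6 ∷ # 7 ∷ [])) refl ; true → hole 6 (n≤1+n 5) (Vec.lookup (# 0 ∷ # 2 ∷ # 5 ∷ # 4 ∷ # 6 ∷ # 7 ∷ [])) refl })
contact-table (false ∷ true ∷ false ∷ false ∷ true ∷ true ∷ [])
  = via-anchor atX 5F 2F refl
contact-table (false ∷ true ∷ false ∷ true ∷ false ∷ false ∷ [])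
  = local (hole 5 ≤-refl (Vec.lookup (# 1 ∷ # 2 ∷ # 5 ∷ # 3 ∷ # 6 ∷ [])) refl)
contact-table (false ∷ true ∷ false ∷ true ∷ false ∷ true ∷ [])
  = via-anchor atX 5F 2F refl
contact-table (false ∷ true ∷ false ∷ true ∷ true ∷ false ∷ [])
  = local (paraglider (Vec.lookup (# 4 ∷ # 6 ∷ # 1 ∷ # 3 ∷ # 0 ∷ [])) refl)
contact-table (false ∷ true ∷ false ∷ true ∷ true ∷ true ∷ [])
  = via-anchor atX 5F 2F refl
contact-table (false ∷ true ∷ true ∷ false ∷ false ∷ false ∷ [])
  = via-anchor atY 1F 4F refl
contact-table (false ∷ true ∷ true ∷ false ∷ false ∷ true ∷ [])
  = via-anchor atY 1F 4F refl
contact-table (false ∷ true ∷ true ∷ false ∷ true ∷ false ∷ [])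
  = via-anchor atY 2F 5F refl
contact-table (false ∷ true ∷ true ∷ false ∷ true ∷ true ∷ [])
  = local (hole 5 ≤-refl (Vec.lookup (# 0 ∷ # 1 ∷ # 6 ∷ # 5 ∷ # 3 ∷ [])) refl)
contact-table (false ∷ true ∷ true ∷ true ∷ false ∷ false ∷ [])
  = local (paraglider (Vec.lookup (# 1 ∷ # 2 ∷ # 0 ∷ # 6 ∷ # 3 ∷ [])) refl)
contact-table (false ∷ true ∷ true ∷ true ∷ false ∷ true ∷ [])
  = local (paraglider (Vec.lookup (# 1 ∷ # 2 ∷ # 0 ∷ # 6 ∷ # 3 ∷ [])) refl)
contact-table (false ∷ true ∷ true ∷ true ∷ true ∷ false ∷ [])
  = local (paraglider (Vec.lookup (# 1 ∷ # 2 ∷ # 0 ∷ # 6 ∷ # 3 ∷ [])) refl)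
contact-table (false ∷ true ∷ true ∷ true ∷ true ∷ true ∷ [])
  = local (paraglider (Vec.lookup (# 1 ∷ # 2 ∷ # 0 ∷ # 6 ∷ # 3 ∷ [])) refl)
contact-table (true ∷ false ∷ false ∷ false ∷ false ∷ false ∷ [])
  = no-contact refl
contact-table (true ∷ false ∷ false ∷ false ∷ false ∷ true ∷ [])
  = local (hole 5 ≤-refl (Vec.lookup (# 0 ∷ # 1 ∷ # 4 ∷ # 5 ∷ # 6 ∷ [])) refl)
contact-table (true ∷ false ∷ false ∷ false ∷ true ∷ false ∷ [])
  = local (hole 5 ≤-refl (Vec.lookup (# 0 ∷ # 2 ∷ # 5 ∷ # 4 ∷ # 6 ∷ [])) refl)
contact-table (true ∷ false ∷ false ∷ false ∷ true ∷ true ∷ [])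
  = local (paraglider (Vec.lookup (# 4 ∷ # 5 ∷ # 3 ∷ # 6 ∷ # 0 ∷ [])) refl)
contact-table (true ∷ false ∷ false ∷ true ∷ false ∷ false ∷ [])
  = no-contact refl
contact-table (true ∷ false ∷ false ∷ true ∷ false ∷ true ∷ [])
  = local (paraglider (Vec.lookup (# 3 ∷ # 6 ∷ # 0 ∷ # 5 ∷ # 2 ∷ [])) refl)
contact-table (true ∷ false ∷ false ∷ true ∷ true ∷ false ∷ [])
  = local (paraglider (Vec.lookup (# 3 ∷ # 6 ∷ # 0 ∷ # 4 ∷ # 1 ∷ [])) refl)
contact-table (true ∷ false ∷ false ∷ true ∷ true ∷ true ∷ [])
  = local (paraglider (Vec.lookup (# 3 ∷ # 6 ∷ # 0 ∷ # 4 ∷ # 1 ∷ [])) refl)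
contact-table (true ∷ false ∷ true ∷ false ∷ false ∷ false ∷ [])
  = via-anchor atY 2F 5F refl
contact-table (true ∷ false ∷ true ∷ false ∷ false ∷ true ∷ [])
  = local (paraglider (Vec.lookup (# 2 ∷ # 6 ∷ # 0 ∷ # 5 ∷ # 3 ∷ [])) refl)
contact-table (true ∷ false ∷ true ∷ false ∷ true ∷ false ∷ [])
  = via-anchor atY 2F 5F refl
contact-table (true ∷ false ∷ true ∷ false ∷ true ∷ true ∷ [])
  = local (paraglider (Vec.lookup (# 0 ∷ # 2 ∷ # 1 ∷ # 6 ∷ # 4 ∷ [])) refl)
contact-table (true ∷ false ∷ true ∷ true ∷ false ∷ false ∷ [])
  = local (paraglider (Vec.lookup (# 0 ∷ # 6 ∷ # 2 ∷ # 3 ∷ # 5 ∷ [])) refl)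
contact-table (true ∷ false ∷ true ∷ true ∷ false ∷ true ∷ [])
  = local (hole 5 ≤-refl (Vec.lookup (# 0 ∷ # 1 ∷ # 4 ∷ # 5 ∷ # 6 ∷ [])) refl)
contact-table (true ∷ false ∷ true ∷ true ∷ true ∷ false ∷ [])
  = local (paraglider (Vec.lookup (# 0 ∷ # 2 ∷ # 1 ∷ # 6 ∷ # 4 ∷ [])) refl)
contact-table (true ∷ false ∷ true ∷ true ∷ true ∷ true ∷ [])
  = local (paraglider (Vec.lookup (# 0 ∷ # 2 ∷ # 1 ∷ # 6 ∷ # 4 ∷ [])) refl)
contact-table (true ∷ true ∷ false ∷ false ∷ false ∷ false ∷ [])
  = via-anchor atY 1F 4F refl
contact-table (true ∷ true ∷ false ∷ false ∷ false ∷ true ∷ [])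
  = via-anchor atY 1F 4F refl
contact-table (true ∷ true ∷ false ∷ false ∷ true ∷ false ∷ [])
  = local (paraglider (Vec.lookup (# 1 ∷ # 6 ∷ # 0 ∷ # 4 ∷ # 3 ∷ [])) refl)
contact-table (true ∷ true ∷ false ∷ false ∷ true ∷ true ∷ [])
  = local (paraglider (Vec.lookup (# 0 ∷ # 1 ∷ # 2 ∷ # 6 ∷ # 5 ∷ [])) refl)
contact-table (true ∷ true ∷ false ∷ true ∷ false ∷ false ∷ [])
  = local (paraglider (Vec.lookup (# 0 ∷ # 6 ∷ # 1 ∷ # 3 ∷ # 4 ∷ [])) refl)
contact-table (true ∷ true ∷ false ∷ true ∷ false ∷ true ∷ [])
  = local (paraglider (Vec.lookup (# 0 ∷ # 1 ∷ # 2 ∷ # 6 ∷ # 5 ∷ [])) refl)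
contact-table (true ∷ true ∷ false ∷ true ∷ true ∷ false ∷ [])
  = local (hole 5 ≤-refl (Vec.lookup (# 0 ∷ # 2 ∷ # 5 ∷ # 4 ∷ # 6 ∷ [])) refl)
contact-table (true ∷ true ∷ false ∷ true ∷ true ∷ true ∷ [])
  = local (paraglider (Vec.lookup (# 0 ∷ # 1 ∷ # 2 ∷ # 6 ∷ # 5 ∷ [])) refl)
contact-table (true ∷ true ∷ true ∷ false ∷ false ∷ false ∷ [])
  = via-anchor atY 1F 4F refl
contact-table (true ∷ true ∷ true ∷ false ∷ false ∷ true ∷ [])
  = via-anchor atY 1F 4F refl
contact-table (true ∷ true ∷ true ∷ false ∷ true ∷ false ∷ [])
  = via-anchor atY 2F 5F refl
contact-table (true ∷ true ∷ true ∷ false ∷ true ∷ true ∷ [])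
  = local (paraglider (Vec.lookup (# 1 ∷ # 6 ∷ # 0 ∷ # 4 ∷ # 3 ∷ [])) refl)
contact-table (true ∷ true ∷ true ∷ true ∷ false ∷ false ∷ [])
  = local (paraglider (Vec.lookup (# 0 ∷ # 6 ∷ # 1 ∷ # 3 ∷ # 4 ∷ [])) refl)
contact-table (true ∷ true ∷ true ∷ true ∷ false ∷ true ∷ [])
  = local (paraglider (Vec.lookup (# 0 ∷ # 6 ∷ # 1 ∷ # 3 ∷ # 4 ∷ [])) refl)
contact-table (true ∷ true ∷ true ∷ true ∷ true ∷ false ∷ [])
  = local (paraglider (Vec.lookup (# 0 ∷ # 6 ∷ # 2 ∷ # 3 ∷ # 5 ∷ [])) refl)
contact-table (true ∷ true ∷ true ∷ true ∷ true ∷ true ∷ [])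
  = complete-contact refl

module Separation (G : Graph) (hf : HoleFree G) (pf : ParagliderFree G)
  (f : Fin 6 → Vtx G) (f-inj : Injective _≡_ _≡_ f)
  (f-adj : ∀ i j → adj G (f i) (f j) ≡ c6barAdj i j) where

  open Paths G
  open Extension G hf pf f f-inj f-adj

  private
    V : Set
    V = Vtx G

  x y a₁ : V
  x  = f 0F
  y  = f 3F
  a₁ = f 1F

  patternOf : V → Pattern
  patternOf w = tabulate (λ j → adj G w (f j))

  pattern-at : ∀ w j → Vec.lookup (patternOf w) j ≡ adj G w (f j)
  pattern-at w j = lookup∘tabulate (λ j → adj G w (f j)) j

  touches complete : V → Bool
  touches w  = touchesOff (patternOf w)
  complete w = completeTo (patternOf w)

  complete-adj : ∀ {w} → complete w ≡ true → ∀ j → adj G w (f j) ≡ true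
  complete-adj {w} e j = trans (sym (pattern-at w j)) (allFin-sound 6 (Vec.lookup (patternOf w)) e j)

  a₁-touches : touches a₁ ≡ true
  a₁-touches = ∨-trueʳ (adj G a₁ a₁) (∨-trueˡ _ (f-adj 1F 2F))

  -- Two vertices complete to A are adjacent: otherwise they would be the
  -- two middle vertices of a paraglider on x, a₁, them and the vertex 5.
  complete-adjacent : ∀ a b → complete a ≡ true → complete b ≡ true → a ≢ b → adj G a b ≡ true
  complete-adjacent a b ca cb a≢b with adj G a b in ab
  ... | true  = refl
  ... | false = ⊥-elim (extension-absurd 2 (λ _ _ → true) (λ _ _ → false) ex ex-A ex-E (λ _ → refl)
                  (λ p j → adj⇒≢ (ex-A p j)) ex-inj
                  (paraglider (Vec.lookup (# 0 ∷ # 1 ∷ # 6 ∷ # 7 ∷ # 5 ∷ [])) refl))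
    where
    ex : Fin 2 → V
    ex 0F = a
    ex 1F = b
    ex-A : ∀ p j → adj G (ex p) (f j) ≡ true
    ex-A 0F = complete-adj ca
    ex-A 1F = complete-adj cb
    ex-E : ∀ p q → p ≢ q → adj G (ex p) (ex q) ≡ false
    ex-E 0F 0F p≢q = ⊥-elim (p≢q refl)
    ex-E 0F 1F _   = ab
    ex-E 1F 0F _   = trans (Graph.sym G b a) ab
    ex-E 1F 1F p≢q = ⊥-elim (p≢q refl)
    ex-inj : Injective _≡_ _≡_ ex
    ex-inj {0F} {0F} _ = refl
    ex-inj {0F} {1F} r = ⊥-elim (a≢b r)
    ex-inj {1F} {0F} r = ⊥-elim (a≢b (sym r))
    ex-inj {1F} {1F} _ = refl

  inK : V → Bool
  inK w = eqF w x ∨ (eqF w y ∨ complete w)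

  K : Subset (n G)
  K = tabulate inK

  OffK : V → Set
  OffK w = inK w ≡ false

  inK⇒∈K : ∀ {w} → inK w ≡ true → w ∈ K
  inK⇒∈K {w} e = lookup⇒[]= w K (trans (lookup∘tabulate inK w) e)

  ∈K⇒inK : ∀ {w} → w ∈ K → inK w ≡ true
  ∈K⇒inK {w} m = trans (sym (lookup∘tabulate inK w)) ([]=⇒lookup m)

  ∉K⇒offK : ∀ {w} → w ∉ K → OffK w
  ∉K⇒offK {w} w∉K with inK w in e
  ... | true  = ⊥-elim (w∉K (inK⇒∈K e))
  ... | false = refl

  offK⇒∉K : ∀ {w} → OffK w → w ∉ K
  offK⇒∉K off w∈K = true≢false (trans (sym (∈K⇒inK w∈K)) off)

  K-members : ∀ w → w ∈ K → w ≡ x ⊎ w ≡ y ⊎ complete w ≡ true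
  K-members w w∈K with ∨-true-split _ _ (∈K⇒inK w∈K)
  ... | inj₁ e = inj₁ (eqF-sound _ _ e)
  ... | inj₂ e with ∨-true-split _ _ e
  ...   | inj₁ e′ = inj₂ (inj₁ (eqF-sound _ _ e′))
  ...   | inj₂ e′ = inj₂ (inj₂ e′)

  K-clique : IsClique G K
  K-clique a b a∈K b∈K a≢b with K-members a a∈K | K-members b b∈K
  ... | inj₁ refl        | inj₁ refl        = ⊥-elim (a≢b refl)
  ... | inj₁ refl        | inj₂ (inj₁ refl) = f-adj 0F 3F
  ... | inj₁ refl        | inj₂ (inj₂ cb)   = trans (Graph.sym G x b) (complete-adj cb 0F)
  ... | inj₂ (inj₁ refl) | inj₁ refl        = f-adj 3F 0F
  ... | inj₂ (inj₁ refl) | inj₂ (inj₁ refl) = ⊥-elim (a≢b refl)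
  ... | inj₂ (inj₁ refl) | inj₂ (inj₂ cb)   = trans (Graph.sym G y b) (complete-adj cb 3F)
  ... | inj₂ (inj₂ ca)   | inj₁ refl        = complete-adj ca 0F
  ... | inj₂ (inj₂ ca)   | inj₂ (inj₁ refl) = complete-adj ca 3F
  ... | inj₂ (inj₂ ca)   | inj₂ (inj₂ cb)   = complete-adjacent a b ca cb a≢b

  offK-intro : ∀ {w} → w ≢ x → w ≢ y → adj G w a₁ ≡ false → OffK w
  offK-intro {w} w≢x w≢y w≁a₁ with eqF w x in e₁ | eqF w y in e₂ | complete w in e₃
  ... | true  | _     | _     = ⊥-elim (w≢x (eqF-sound _ _ e₁))
  ... | false | true  | _     = ⊥-elim (w≢y (eqF-sound _ _ e₂))
  ... | false | false | true  = ⊥-elim (true≢false (trans (sym (complete-adj e₃ 1F)) w≁a₁))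
  ... | false | false | false = refl

  offK⇒≢x : ∀ {w} → OffK w → w ≢ x
  offK⇒≢x {w} off refl = true≢false (trans (sym (∨-trueˡ _ (eqF-refl w))) off)

  offK⇒≢y : ∀ {w} → OffK w → w ≢ y
  offK⇒≢y {w} off refl = true≢false (trans (sym (∨-trueʳ (eqF w x) (∨-trueˡ _ (eqF-refl w)))) off)

  Clean : V → Set
  Clean w = OffK w × (∀ j → onXY j ≡ false → adj G w (f j) ≡ false)

  CleanOr : V → V → Set
  CleanOr z w = Clean w ⊎ w ≡ z

  clean-intro : ∀ {w} → Outside G f w → (∀ j → adj G w (f j) ≡ true → j ≡ 0F ⊎ j ≡ 3F) → Clean w
  clean-intro {w} out only-xy = offK-intro (out 0F) (out 3F) (sees-off 1F refl) , sees-off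
    where
    sees-off : ∀ j → onXY j ≡ false → adj G w (f j) ≡ false
    sees-off j off with adj G w (f j) in e
    ... | false = refl
    ... | true with only-xy j e
    ...   | inj₁ refl = ⊥-elim (true≢false off)
    ...   | inj₂ refl = ⊥-elim (true≢false off)

  clean-untouched : ∀ {w} → Clean w → touches w ≡ false
  clean-untouched {w} (_ , off) rewrite pattern-at w 1F | pattern-at w 2F | pattern-at w 4F | pattern-at w 5F
    | off 1F refl | off 2F refl | off 4F refl | off 5F refl = refl

  untouched-clean : ∀ {w} → OffK w → touches w ≡ false → Clean w
  untouched-clean {w} offK none = offK , sees-off
    where
    sees : Fin 6 → Bool
    sees j = adj G w (f j)
    sees-off : ∀ j → onXY j ≡ false → sees j ≡ false
    sees-off 1F _ = ∨-conicalˡ (sees 1F) _ none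
    sees-off 2F _ = ∨-conicalˡ (sees 2F) _ (∨-conicalʳ (sees 1F) _ none)
    sees-off 4F _ = ∨-conicalˡ (sees 4F) _ (∨-conicalʳ (sees 2F) _ (∨-conicalʳ (sees 1F) _ none))
    sees-off 5F _ = ∨-conicalʳ (sees 4F) _ (∨-conicalʳ (sees 2F) _ (∨-conicalʳ (sees 1F) _ none))

  -- a clean vertex is not in A: it lies outside K, so it is neither x nor y,
  -- and each vertex of A off xy has a neighbour off xy, which it does not see
  clean-outside : ∀ {w} → Clean w → ∀ j → w ≢ f j
  clean-outside (off , _) 0F = offK⇒≢x off
  clean-outside (off , _) 3F = offK⇒≢y off
  clean-outside (_ , sees) 1F refl = true≢false (trans (sym (f-adj 1F 2F)) (sees 2F refl))
  clean-outside (_ , sees) 2F refl = true≢false (trans (sym (f-adj 2F 1F)) (sees 1F refl))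
  clean-outside (_ , sees) 4F refl = true≢false (trans (sym (f-adj 4F 5F)) (sees 5F refl))
  clean-outside (_ , sees) 5F refl = true≢false (trans (sym (f-adj 5F 4F)) (sees 4F refl))

  record FirstContact (a : V) : Set where
    field
      z            : V
      prefix       : List V
      walk         : Walk (a ∷ prefix)
      ends         : Last (a ∷ prefix) z
      clean        : All (CleanOr z) (a ∷ prefix)
      z-touches    : touches z ≡ true
      z-offK       : OffK z
      before       : V
      before-clean : Clean before
      before-z     : adj G before z ≡ true

  first-contact : (a : V) (l : List V) → Walk (a ∷ l) → Last (a ∷ l) a₁ → All OffK (a ∷ l) →
    touches a ≡ false → FirstContact a
  first-contact a [] _ last-here _ untouched = ⊥-elim (true≢false (trans (sym a₁-touches) untouched))
  first-contact a (b ∷ l) (a-b , walk) end (a-off ∷ offs) untouched with touches b in b-touches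
  ... | true = record
    { z = b ; prefix = b ∷ [] ; walk = a-b , tt ; ends = last-there last-here
    ; clean = inj₁ a-clean ∷ inj₂ refl ∷ [] ; z-touches = b-touches ; z-offK = All.head offs
    ; before = a ; before-clean = a-clean ; before-z = a-b }
    where
    a-clean : Clean a
    a-clean = untouched-clean a-off untouched
  ... | false = record
    { z = z ; prefix = b ∷ prefix ; walk = a-b , walk′ ; ends = last-there ends
    ; clean = inj₁ (untouched-clean a-off untouched) ∷ clean ; z-touches = z-touches ; z-offK = z-offK
    ; before = before ; before-clean = before-clean ; before-z = before-z }
    where open FirstContact (first-contact b l walk (Last-tail end) offs b-touches) renaming (walk to walk′)

  -- the first contact lies outside A: it is neither x nor y, and it has a
  -- clean neighbour, which no vertex of A off xy has
  z-outside : ∀ {a} (c : FirstContact a) → Outside G f (FirstContact.z c)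
  z-outside c j with onXY j in off
  ... | false = λ z≡fj → true≢false
                  (trans (sym (subst (λ v → adj G before v ≡ true) z≡fj before-z)) (proj₂ before-clean j off))
    where open FirstContact c
  z-outside c 0F | true = offK⇒≢x (FirstContact.z-offK c)
  z-outside c 3F | true = offK⇒≢y (FirstContact.z-offK c)

  record Entrance (s₀ : V) (a : Anchor) : Set where
    field
      p         : V
      p-anchor  : adj G p (f (anchor a)) ≡ true
      p-clean   : Clean p
      p-start   : p ≡ s₀ ⊎ adj G p s₀ ≡ true

  module NoEscape (s₀ : V) (l : List V) (walk₀ : Walk (s₀ ∷ l)) (end₀ : Last (s₀ ∷ l) a₁)
    (offK₀ : All OffK (s₀ ∷ l)) (untouched₀ : touches s₀ ≡ false)
    (entrance : (a : Anchor) → Entrance s₀ a) where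

    open FirstContact (first-contact s₀ l walk₀ end₀ offK₀ untouched₀)

    s : Pattern
    s = patternOf z

    z-sees : ∀ {j b} → Vec.lookup s j ≡ b → adj G z (f j) ≡ b
    z-sees {j} e = trans (sym (pattern-at z j)) e

    sees-z : ∀ {j b} → Vec.lookup s j ≡ b → adj G (f j) z ≡ b
    sees-z {j} e = trans (Graph.sym G (f j) z) (z-sees e)

    cleanOr-outside : ∀ {w} → CleanOr z w → ∀ j → w ≢ f j
    cleanOr-outside (inj₁ w-clean) = clean-outside w-clean
    cleanOr-outside (inj₂ refl)    = z-outside (first-contact s₀ l walk₀ end₀ offK₀ untouched₀)

    near-only-z : ∀ j → onXY j ≡ false → ∀ {w} → CleanOr z w → w ≡ z ⊎ Far (f j) w
    near-only-z j off (inj₁ w-clean) =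
      inj₂ (trans (Graph.sym G _ _) (proj₂ w-clean j off) , λ r → clean-outside w-clean j (sym r))
    near-only-z j off (inj₂ w≡z) = inj₁ w≡z

    far-if-z-far : ∀ j → onXY j ≡ false → adj G z (f j) ≡ false → ∀ {w} → CleanOr z w → Far (f j) w
    far-if-z-far j off z-far cw with near-only-z j off cw
    ... | inj₂ far  = far
    ... | inj₁ refl = trans (Graph.sym G _ _) z-far , λ r → cleanOr-outside cw j (sym r)

    far-from : ∀ j {ws} → All (λ w → adj G (f j) w ≡ false) ws → All (CleanOr z) ws → All (Far (f j)) ws
    far-from j nonadj cws = All.zipWith (λ (n , cw) → n , λ r → cleanOr-outside cw j (sym r)) (nonadj , cws)

    anchor-path : (a : Anchor) → PathFrom (CleanOr z) (f (anchor a)) z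
    anchor-path a = from-walk p-start
      where
      open Entrance (entrance a)
      from-walk : p ≡ s₀ ⊎ adj G p s₀ ≡ true → PathFrom (CleanOr z) (f (anchor a)) z
      from-walk (inj₁ p≡s₀) = path-from (f (anchor a)) s₀ prefix walk ends clean
        (subst (λ v → adj G v (f (anchor a)) ≡ true) p≡s₀ p-anchor)
      from-walk (inj₂ p-s₀) =
        path-from (f (anchor a)) p (s₀ ∷ prefix) (p-s₀ , walk) (last-there ends) (inj₁ p-clean ∷ clean) p-anchor

    z-alone : Obstruction (withZ s) → ⊥
    z-alone = extension-absurd 1 (λ _ → Vec.lookup s) (λ _ _ → false) (λ _ → z) (λ _ j → z-sees refl)
      (λ { 0F 0F p≢q → ⊥-elim (p≢q refl) }) (λ _ → refl) (λ _ → cleanOr-outside (inj₂ refl)) (λ { {0F} {0F} _ → refl })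

    z-with-clean-neighbour : ∀ {c} → Clean c → adj G x c ≡ true → adj G c z ≡ true →
      Obstruction (withZC s (adj G c y)) → ⊥
    z-with-clean-neighbour {c} c-clean x-c c-z =
      extension-absurd 2 (zcPattern s (adj G c y)) (λ p q → not (eqF p q)) ex ex-A ex-E
        (λ { 0F → refl ; 1F → refl }) ex-out ex-inj
      where
      ex : Fin 2 → V
      ex 0F = z
      ex 1F = c
      ex-A : ∀ p j → adj G (ex p) (f j) ≡ zcPattern s (adj G c y) p j
      ex-A 0F j  = z-sees refl
      ex-A 1F 0F = trans (Graph.sym G c x) x-c
      ex-A 1F 1F = proj₂ c-clean 1F refl
      ex-A 1F 2F = proj₂ c-clean 2F refl
      ex-A 1F 3F = refl
      ex-A 1F 4F = proj₂ c-clean 4F refl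
      ex-A 1F 5F = proj₂ c-clean 5F refl
      ex-E : ∀ p q → p ≢ q → adj G (ex p) (ex q) ≡ not (eqF p q)
      ex-E 0F 0F p≢q = ⊥-elim (p≢q refl)
      ex-E 0F 1F _   = trans (Graph.sym G z c) c-z
      ex-E 1F 0F _   = c-z
      ex-E 1F 1F p≢q = ⊥-elim (p≢q refl)
      ex-out : ∀ p j → ex p ≢ f j
      ex-out 0F = cleanOr-outside (inj₂ refl)
      ex-out 1F = clean-outside c-clean
      ex-inj : Injective _≡_ _≡_ ex
      ex-inj {0F} {0F} _ = refl
      ex-inj {0F} {1F} r = ⊥-elim (adj⇒≢ c-z (sym r))
      ex-inj {1F} {0F} r = ⊥-elim (adj⇒≢ c-z r)
      ex-inj {1F} {1F} _ = refl

    -- the hole t' – a – c – … – z – t – t'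
    anchor-hole : (a : Anchor) (t t' : Fin 6) → AnchorHole s a t t' → ⊥
    anchor-hole a t t' h = closes (anchor-path a)
      where
      open AnchorHole h
      closes : PathFrom (CleanOr z) (f (anchor a)) z → ⊥
      closes record { rest = [] ; ends = last-here ; v-start = a-z } =
        true≢false (trans (sym a-z) (sees-z z-a))
      closes record { start = c ; rest = w ∷ rest ; induced = induced ; ends = ends
                    ; inside = c-in ∷ rest-in ; v-start = a-c ; v-rest = a-rest } =
        hf _ (m≤m+n 5 (length rest))
          (induced-cycle (f t) (f t') z (f (anchor a) ∷ c ∷ w ∷ rest)
            ( trans (f-adj t' (anchor a)) t'-a
            , All.map (far-if-z-far t' t'-off (z-sees z-t')) (c-in ∷ rest-in)
            , a-c , far-from (anchor a) a-rest rest-in , induced )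
            (last-there (last-there ends))
            (trans (f-adj t t') t-t')
            (sees-z z-t)
            ( inj₂ (trans (f-adj t (anchor a)) t-a , λ r → off-anchor a t-off (f-inj r))
            ∷ All.map (near-only-z t t-off) (c-in ∷ rest-in) ))

    -- the hole x – c – … – z – t – x, or an obstruction on A + z + c when
    -- the path is x – c – z
    x-hole : (t : Fin 6) → XHole s t → ((c-y : Bool) → Obstruction (withZC s c-y)) → ⊥
    x-hole t h obstruction = closes (anchor-path atX)
      where
      open XHole h
      closes : PathFrom (CleanOr z) x z → ⊥
      closes record { rest = [] ; ends = last-here ; v-start = x-z } =
        true≢false (trans (sym x-z) (sees-z z-x))
      closes record { rest = _ ∷ [] ; induced = c-z , _ ; ends = last-there last-here
                    ; inside = inj₂ refl ∷ _ ; v-start = x-z } =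
        true≢false (trans (sym x-z) (sees-z z-x))
      closes record { rest = _ ∷ [] ; induced = c-z , _ ; ends = last-there last-here
                    ; inside = inj₁ c-clean ∷ _ ; v-start = x-c } =
        z-with-clean-neighbour c-clean x-c c-z (obstruction _)
      closes record { start = c ; rest = w ∷ w₂ ∷ rest ; induced = induced ; ends = ends
                    ; inside = c-in ∷ rest-in ; v-start = x-c ; v-rest = x-rest } =
        hf _ (m≤m+n 5 (length rest))
          (induced-cycle (f t) x z (c ∷ w ∷ w₂ ∷ rest)
            (x-c , far-from 0F x-rest rest-in , induced)
            (last-there ends)
            (trans (f-adj t 0F) t-x)
            (sees-z z-t)
            (All.map (near-only-z t t-off) (c-in ∷ rest-in)))

    no-escape : ⊥
    no-escape with contact-table s
    ... | no-contact none       = true≢false (trans (sym z-touches) none)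
    ... | complete-contact all  =
      true≢false (trans (sym (∨-trueʳ (eqF z x) (∨-trueʳ (eqF z y) all))) z-offK)
    ... | local o               = z-alone o
    ... | via-anchor a t t' ok  = anchor-hole a t t' (anchorHole-sound s a t t' ok)
    ... | via-x t ok o          = x-hole t (xHole-sound s t ok) o

  a₁-offK : OffK a₁
  a₁-offK = offK-intro (λ r → 1≢0 (f-inj r)) (λ r → 1≢3 (f-inj r)) (irrefl G a₁)
    where
    1≢0 : 1F ≢ 0F
    1≢0 ()
    1≢3 : 1F ≢ 3F
    1≢3 ()

  -- A clean neighbour w of x is joined to a₁ through x; if no walk avoiding
  -- K joins them, the clique K is a clique separator.
  separated : Atom G → (w : V) → Clean w → adj G w x ≡ true → ¬ Reach G (λ c → c ∉ K) w a₁ → ⊥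
  separated atom w w-clean w-x no-walk = atom K
    ( K-clique , w , a₁ , offK⇒∉K (proj₁ w-clean) , offK⇒∉K a₁-offK
    , step w-x tt (step (f-adj 0F 1F) tt here) , no-walk )

  -- A₂[xy] = ∅: a vertex u outside A with N(u) ∩ V(A) = {x, y} is clean and
  -- is its own entrance at x and at y, so no walk avoiding K leads from u to a₁.
  A₂-empty : Atom G → (u : V) → Outside G f u → NbhdOn G f u (λ w → w ≡ x ⊎ w ≡ y) → ⊥
  A₂-empty atom u out nbhd = separated atom u u-clean u-x no-walk
    where
    u-clean : Clean u
    u-clean = clean-intro out λ j e → ⊎-map f-inj f-inj (Equivalence.to (nbhd j) e)
    u-x : adj G u x ≡ true
    u-x = Equivalence.from (nbhd 0F) (inj₁ refl)
    u-y : adj G u y ≡ true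
    u-y = Equivalence.from (nbhd 3F) (inj₂ refl)
    entrance : (a : Anchor) → Entrance u a
    entrance atX = record { p = u ; p-anchor = u-x ; p-clean = u-clean ; p-start = inj₁ refl }
    entrance atY = record { p = u ; p-anchor = u-y ; p-clean = u-clean ; p-start = inj₁ refl }
    no-walk : ¬ Reach G (λ c → c ∉ K) u a₁
    no-walk r = NoEscape.no-escape u rest walk ends (proj₁ u-clean ∷ All.map ∉K⇒offK inside)
                  (clean-untouched u-clean) entrance
      where open WalkIn (reach-walk r)

  -- A₁[xy] = ∅: for an edge uv with N(u) ∩ V(A) = {x} and N(v) ∩ V(A) = {y},
  -- both ends are clean; prefixing v to a walk from u gives a walk from v
  -- with entrance u at x and v at y.
  A₁-empty : Atom G → (u v : V) → adj G u v ≡ true → Outside G f u → Outside G f v →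
    NbhdOn G f u (λ w → w ≡ x) → NbhdOn G f v (λ w → w ≡ y) → ⊥
  A₁-empty atom u v u-v out-u out-v nbhd-u nbhd-v = separated atom u u-clean u-x no-walk
    where
    u-clean : Clean u
    u-clean = clean-intro out-u λ j e → inj₁ (f-inj (Equivalence.to (nbhd-u j) e))
    v-clean : Clean v
    v-clean = clean-intro out-v λ j e → inj₂ (f-inj (Equivalence.to (nbhd-v j) e))
    u-x : adj G u x ≡ true
    u-x = Equivalence.from (nbhd-u 0F) refl
    v-y : adj G v y ≡ true
    v-y = Equivalence.from (nbhd-v 3F) refl
    entrance : (a : Anchor) → Entrance v a
    entrance atX = record { p = u ; p-anchor = u-x ; p-clean = u-clean ; p-start = inj₂ u-v }
    entrance atY = record { p = v ; p-anchor = v-y ; p-clean = v-clean ; p-start = inj₁ refl }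
    no-walk : ¬ Reach G (λ c → c ∉ K) u a₁
    no-walk r = NoEscape.no-escape v (u ∷ rest) (trans (Graph.sym G v u) u-v , walk) (last-there ends)
                  (proj₁ v-clean ∷ proj₁ u-clean ∷ All.map ∉K⇒offK inside) (clean-untouched v-clean) entrance
      where open WalkIn (reach-walk r)

next : Fin 3 → Fin 3
next 0F = 1F
next 1F = 2F
next 2F = 0F

rotation : Fin 3 → Fin 6 → Fin 6
rotation i 0F = leftV i
rotation i 1F = leftV (next i)
rotation i 2F = leftV (next (next i))
rotation i 3F = rightV i
rotation i 4F = rightV (next i)
rotation i 5F = rightV (next (next i))

rotation-automorphism : ∀ i → inducedCopy 6 c6barAdj c6barAdj (rotation i) ≡ true
rotation-automorphism 0F = refl
rotation-automorphism 1F = refl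
rotation-automorphism 2F = refl

-- The theorem: apply the separation argument to the rotated copy f ∘ ρ;
-- since ρ 0 = leftV i and ρ 3 = rightV i by definition, the neighbourhood
-- hypotheses about f restrict pointwise to those about f ∘ ρ.
lemma1 : (G : Graph) → HoleFree G → ParagliderFree G → Atom G →
    (f : Fin 6 → Vtx G) → Injective _≡_ _≡_ f → (∀ i j → adj G (f i) (f j) ≡ c6barAdj i j) →
    (i : Fin 3) →
    ((u : Vtx G) → Outside G f u →
       NbhdOn G f u (λ w → w ≡ f (leftV i) ⊎ w ≡ f (rightV i)) → ⊥)
    ×
    ((u v : Vtx G) → adj G u v ≡ true → Outside G f u → Outside G f v →
       NbhdOn G f u (λ w → w ≡ f (leftV i)) →
       NbhdOn G f v (λ w → w ≡ f (rightV i)) → ⊥)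
lemma1 G hf pf atom f f-inj f-adj i =
  (λ u out nbhd → A₂-empty atom u (λ j → out (ρ j)) (λ j → nbhd (ρ j))) ,
  (λ u v u-v out-u out-v nbhd-u nbhd-v →
     A₁-empty atom u v u-v (λ j → out-u (ρ j)) (λ j → out-v (ρ j)) (λ j → nbhd-u (ρ j)) (λ j → nbhd-v (ρ j)))
  where
  ρ : Fin 6 → Fin 6
  ρ = rotation i
  rotated : Embeds G 6 c6barAdj
  rotated = embeds-via G c6barAdj c6barAdj ρ f f-inj f-adj (rotation-automorphism i)
  open Separation G hf pf (λ j → f (ρ j)) (proj₁ (proj₂ rotated)) (proj₂ (proj₂ rotated))
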